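{- For every signed graph $(G,\sigma)$, $\chi\big(\hat{G}^{[\sharp -2]}_{\mathrm{strong}}\big)\le \mathrm{col}_2(G)^2\cdot 2^{\mathrm{col}_2(G)}$.
   Context: A signed graph $(G,\sigma)$ is a finite simple graph $G$ with $\sigma:E(G)\to\{+,-\}$; the sign of a path is the product of its edge signs. The strong exact-distance $-2$ graph $\hat{G}^{[\sharp -2]}_{\mathrm{strong}}$ is the graph on $V(G)$ in which $xy$ is an edge iff $d_G(x,y)=2$ and some $xy$-path of length $2$ is negative. For a total ordering $L$ of $V(G)$, a vertex $x$ is strongly $r$-reachable from $y$ if there is an $xy$-path $P$ of length at most $r$ with $x\le_L z$ for all $z\in V(P)$ and $y\le_L z$ for all $z\in V(P)\setminus\{x\}$; $\mathrm{Reach}_r[G,L,y]$ is the set of such $x$ (including $y$). $\mathrm{col}_r(G)=\min_L\max_v|\mathrm{Reach}_r[G,L,v]|$. -}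

module Defs where

open import Data.Nat using (ℕ; _≤_; _⊔_; _≤ᵇ_)
open import Data.Bool using (Bool; true; false; _∧_; _∨_; not; _xor_)
open import Data.Fin using (Fin; _≟_)
open import Data.List using (List; length; filter; foldr; map)
open import Data.Bool.ListAction using (any)
open import Data.Product using (Σ; ∃; _×_; _,_)
open import Relation.Binary.PropositionalEquality using (_≡_; _≢_)
open import Relation.Nullary.Decidable using (⌊_⌋)
open import Relation.Nullary using (¬_)
open import Function.Definitions using (Injective)
open import Data.List using () renaming (allFin to allFinL)
open import Data.Bool using (T)

record Graph (n : ℕ) : Set where
  field
    adj    : Fin n → Fin n → Bool
    sym    : ∀ x y → adj x y ≡ adj y x
    irrefl : ∀ x → adj x x ≡ false
open Graph public

-- A signature on G: sign x y = true means the edge xy is negative (−),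
-- false means positive (+).  Only its values on edges matter.
record Signature {n : ℕ} (G : Graph n) : Set where
  field
    sign    : Fin n → Fin n → Bool
    signSym : ∀ x y → sign x y ≡ sign y x
open Signature public

Dist2 : ∀ {n} → Graph n → Fin n → Fin n → Set
Dist2 G x y = x ≢ y × adj G x y ≡ false × ∃ λ z → adj G x z ≡ true × adj G z y ≡ true

-- edge relation of the strong exact-distance (−2) graph:
-- d_G(x,y)=2 and some xy-path x z y of length 2 is negative
-- (product of signs negative  ⇔  exactly one of its two edges is negative).
StrongExD2Edge : ∀ {n} (G : Graph n) → Signature G → Fin n → Fin n → Set
StrongExD2Edge G σ x y =
  Dist2 G x y × ∃ λ z → adj G x z ≡ true × adj G z y ≡ true
                        × (sign σ x z xor sign σ z y) ≡ true

ProperColouring : ∀ {n} (E : Fin n → Fin n → Set) (m : ℕ) → Set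
ProperColouring {n} E m =
  Σ (Fin n → Fin m) λ c → ∀ x y → E x y → c x ≢ c y

-- A total ordering L of V(G) is represented by an injective rank
-- function Fin n → ℕ (x ≤_L z iff L x ≤ L z).
Ordering : ℕ → Set
Ordering n = Σ (Fin n → ℕ) λ L → Injective _≡_ _≡_ L

-- x is strongly 2-reachable from y w.r.t. L (Boolean).  An xy-path of
-- length ≤ 2 is either trivial (x = y), an edge xy, or x z y with
-- x ≠ y and z adjacent to both (z ≠ x, y automatically by irreflexivity).
-- Conditions: x ≤_L every vertex of P, y ≤_L every vertex of P other than x.
strongReach2 : ∀ {n} → Graph n → (Fin n → ℕ) → Fin n → Fin n → Bool
strongReach2 {n} G L y x =
  ⌊ x ≟ y ⌋
  ∨ (adj G x y ∧ (L x ≤ᵇ L y))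
  ∨ (not ⌊ x ≟ y ⌋ ∧ any (λ z → adj G x z ∧ adj G z y
                                 ∧ (L x ≤ᵇ L z) ∧ (L x ≤ᵇ L y) ∧ (L y ≤ᵇ L z))
                         (allFinL n))

reachSize : ∀ {n} → Graph n → (Fin n → ℕ) → Fin n → ℕ
reachSize {n} G L y = length (filter (λ x → T? (strongReach2 G L y x)) (allFinL n))
  where
  open import Data.Bool using () renaming (T? to T?)

maxReach : ∀ {n} → Graph n → (Fin n → ℕ) → ℕ
maxReach {n} G L = foldr _⊔_ 0 (map (reachSize G L) (allFinL n))

IsCol2 : ∀ {n} → Graph n → ℕ → Set
IsCol2 {n} G k =
  (∃ λ (L : Ordering n) → maxReach G (Data.Product.proj₁ L) ≡ k)
  × (∀ (L : Ordering n) → k ≤ maxReach G (Data.Product.proj₁ L))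
  where import Data.Product

-- Fix an ordering L attaining col₂(G) = k and let  earlier v  be Reach₂[G,L,v] ∖ {v}: fewer
-- than k vertices, all preceding v.  Colouring greedily along L gives φ with k colours
-- separating every v from  earlier v,  and ψ with k² colours separating every v also from the
-- earlier vertices of its earlier vertices.  Two earlier neighbours of v are strongly
-- 2-reachable from one another through v, so they get distinct φ-colours, and the signs of the
-- edges from v to its earlier neighbours fit into k bits indexed by φ.  Colour v by ψ(v) and
-- these bits.  Let x z y be a negative path between vertices at distance 2.  If x comes first
-- among x, y, z, then x ∈ earlier y (when y precedes z), or x ∈ earlier z and z ∈ earlier y,
-- so ψ separates x and y; symmetrically if y comes first.  If z comes first, equal bits
-- would give both edges of the path the same sign.
module Submission where

open import Defs hiding (sym)
open import Data.Nat using (ℕ; zero; suc; _*_; _^_; _≤_; _<_; _⊔_; _≤ᵇ_; z≤n; s≤s; _≟_; _≤?_)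
open import Data.Nat.Properties
  using ( ≤-trans; ≤-total; <-trans; <-≤-trans; ≤-<-trans; ≤∧≢⇒<; <-irrefl; m≤m⊔n; m≤n⊔m
        ; m<1+n⇒m<n∨m≡n; m<1+n⇒m≤n; n≤1+n; +-mono-≤; *-mono-≤; ≤⇒≤ᵇ; ≤ᵇ⇒≤ )
open import Data.Bool using (Bool; true; false; T; T?; _∧_; _xor_; not) renaming (_≟_ to _≟B_)
open import Data.Bool.ListAction using (any)
open import Data.Bool.Properties using (T-∨; T-∧; T-≡; xor-same)
open import Data.Fin using (Fin; zero; suc; combine; fromℕ<) renaming (_≟_ to _≟F_)
open import Data.Fin.Properties as Fin
  using (pigeonhole; <⇒≢; ¬∀⟶∃¬; combine-injectiveˡ; combine-injectiveʳ)
open import Data.List using (List; []; _∷_; length; filter; foldr; map; concatMap; _++_; lookup)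
  renaming (allFin to allFinL)
open import Data.List.Properties using (length-++; length-map; filter-notAll)
open import Data.List.Membership.Propositional using (_∈_; _∉_; lose; find)
open import Data.List.Membership.Propositional.Properties
  using (∈-allFin; ∈-map⁺; ∈-filter⁺; ∈-filter⁻; ∈-++⁺ˡ; ∈-++⁺ʳ; ∈-++⁻; ∈-concatMap⁺; ∈-concatMap⁻)
open import Data.List.Relation.Unary.Any as Any using (here; there; index; satisfied)
open import Data.List.Relation.Unary.Any.Properties using (lookup-index; any⁺; any⁻)
open import Data.Product using (∃; _×_; _,_; proj₁; proj₂)
open import Data.Empty using (⊥)
open import Data.Sum using (_⊎_; inj₁; inj₂)
open import Data.Vec.Functional using (updateAt)
open import Data.Vec.Functional.Properties using (updateAt-updates; updateAt-minimal)
open import Function using (_∘_; const)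
open import Function.Bundles using (_⇔_; mk⇔; module Equivalence)
open import Function.Definitions using (Injective)
open import Relation.Nullary using (¬_; ¬?; yes; no; does; contradiction; _×-dec_)
open import Relation.Nullary.Decidable using (⌊_⌋; fromWitness; fromWitnessFalse; toWitness; dec-true; dec-false)
open import Relation.Binary.PropositionalEquality
  using (_≡_; _≢_; _≗_; refl; sym; trans; cong; subst; module ≡-Reasoning)

open Equivalence using (to; from)

∈⇒≤-foldr-⊔ : ∀ {A : Set} (f : A → ℕ) {xs x} → x ∈ xs → f x ≤ foldr _⊔_ 0 (map f xs)
∈⇒≤-foldr-⊔ f {y ∷ _} (here refl)  = m≤m⊔n (f y) _
∈⇒≤-foldr-⊔ f {y ∷ _} (there x∈xs) = ≤-trans (∈⇒≤-foldr-⊔ f x∈xs) (m≤n⊔m (f y) _)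

minimum-of-three : ∀ a b c → (a ≤ b × a ≤ c) ⊎ (b ≤ a × b ≤ c) ⊎ (c ≤ a × c ≤ b)
minimum-of-three a b c with ≤-total a b | ≤-total a c | ≤-total b c
... | inj₁ a≤b | inj₁ a≤c | _        = inj₁ (a≤b , a≤c)
... | inj₁ a≤b | inj₂ c≤a | _        = inj₂ (inj₂ (c≤a , ≤-trans c≤a a≤b))
... | inj₂ b≤a | _        | inj₁ b≤c = inj₂ (inj₁ (b≤a , b≤c))
... | inj₂ b≤a | _        | inj₂ c≤b = inj₂ (inj₂ (≤-trans c≤b b≤a , c≤b))

length<⇒∃∉ : ∀ {m} (xs : List (Fin m)) → length xs < m → ∃ λ i → i ∉ xs
length<⇒∃∉ {m} xs |xs|<m = ¬∀⟶∃¬ m (_∈ xs) (λ i → Any.any? (i ≟F_) xs) not-all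
  where
  not-all : ¬ (∀ i → i ∈ xs)
  not-all all with i , j , i<j , same-index ← pigeonhole |xs|<m (λ i → index (all i)) =
    <⇒≢ i<j (trans (lookup-index (all i))
                   (trans (cong (lookup xs) same-index) (sym (lookup-index (all j)))))

length-concatMap-≤ : ∀ {A B : Set} {d} (f : A → List B) → (∀ x → length (f x) ≤ d)
  → ∀ xs → length (concatMap f xs) ≤ length xs * d
length-concatMap-≤ f |f|≤d []       = z≤n
length-concatMap-≤ f |f|≤d (x ∷ xs) =
  subst (_≤ _) (sym (length-++ (f x))) (+-mono-≤ (|f|≤d x) (length-concatMap-≤ f |f|≤d xs))

length-++-concatMap-< : ∀ {A : Set} {k} (f : A → List A) → (∀ x → length (f x) < k)
  → ∀ xs → length xs < k → length (xs ++ concatMap f xs) < k * k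
length-++-concatMap-< {k = suc d} f |f|<k xs |xs|<k =
  subst (_< suc d * suc d) (sym (length-++ xs))
    (s≤s (+-mono-≤ (m<1+n⇒m≤n |xs|<k)
      (≤-trans (length-concatMap-≤ f (m<1+n⇒m≤n ∘ |f|<k) xs)
               (*-mono-≤ (m<1+n⇒m≤n |xs|<k) (n≤1+n d)))))

bit : Bool → Fin 2
bit false = zero
bit true  = suc zero

bit-injective : ∀ {a b} → bit a ≡ bit b → a ≡ b
bit-injective {false} {false} _ = refl
bit-injective {true}  {true}  _ = refl

bits→Fin : ∀ {m} → (Fin m → Bool) → Fin (2 ^ m)
bits→Fin {zero}  f = zero
bits→Fin {suc m} f = combine (bit (f zero)) (bits→Fin (f ∘ suc))

bits→Fin-injective : ∀ {m} (f g : Fin m → Bool) → bits→Fin f ≡ bits→Fin g → f ≗ g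
bits→Fin-injective {suc m} f g same zero =
  bit-injective (combine-injectiveˡ (bit (f zero)) _ (bit (g zero)) _ same)
bits→Fin-injective {suc m} f g same (suc i) =
  bits→Fin-injective (f ∘ suc) (g ∘ suc) (combine-injectiveʳ (bit (f zero)) _ (bit (g zero)) _ same) i

T-∧⁵ : ∀ {a b c d e} → T (a ∧ b ∧ c ∧ d ∧ e) ⇔ (T a × T b × T c × T d × T e)
T-∧⁵ {true}  {true}  {true}  {true}  {true}  = mk⇔ (const _) (const _)
T-∧⁵ {false}                                 = mk⇔ (λ ()) (λ { (() , _) })
T-∧⁵ {true}  {false}                         = mk⇔ (λ ()) (λ { (_ , () , _) })
T-∧⁵ {true}  {true}  {false}                 = mk⇔ (λ ()) (λ { (_ , _ , () , _) })
T-∧⁵ {true}  {true}  {true}  {false}         = mk⇔ (λ ()) (λ { (_ , _ , _ , () , _) })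
T-∧⁵ {true}  {true}  {true}  {true}  {false} = mk⇔ (λ ()) (λ { (_ , _ , _ , _ , ()) })

module GreedyColouring {n m : ℕ} (L : Fin n → ℕ) (L-injective : Injective _≡_ _≡_ L)
  (C : Fin n → List (Fin n)) (|C|<m : ∀ v → length (C v) < m)
  (C-earlier : ∀ {v u} → u ∈ C v → L u < L v) where

  Separates : (Fin n → Fin m) → ℕ → Set
  Separates c t = ∀ {v u} → L v < t → u ∈ C v → c u ≢ c v

  separates-suc : ∀ {c t w} → Separates c t → L w ≡ t → ∀ {new} → new ∉ map c (C w)
    → Separates (updateAt c w (const new)) (suc t)
  separates-suc {c} {t} {w} sep Lw≡t {new} new∉ {v} {u} Lv<1+t u∈Cv =
    by-rank (m<1+n⇒m<n∨m≡n Lv<1+t)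
    where
    unchanged : ∀ {x} → x ≢ w → updateAt c w (const new) x ≡ c x
    unchanged {x} = updateAt-minimal x w c
    u≢w : u ≢ w
    u≢w refl = <-irrefl Lw≡t (<-≤-trans (C-earlier u∈Cv) (m<1+n⇒m≤n Lv<1+t))
    by-rank : L v < t ⊎ L v ≡ t → updateAt c w (const new) u ≢ updateAt c w (const new) v
    by-rank (inj₁ Lv<t) same =
      sep Lv<t u∈Cv (trans (sym (unchanged u≢w)) (trans same (unchanged v≢w)))
      where
      v≢w : v ≢ w
      v≢w refl = <-irrefl Lw≡t Lv<t
    by-rank (inj₂ Lv≡t) same with refl ← L-injective (trans Lv≡t (sym Lw≡t)) =
      new∉ (subst (_∈ map c (C w)) (trans (sym (unchanged u≢w)) (trans same (updateAt-updates w c)))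
                  (∈-map⁺ c u∈Cv))

  colouringBelow : ∀ t → ∃ λ c → Separates c t
  colouringBelow zero = (λ v → fromℕ< (≤-<-trans z≤n (|C|<m v))) , λ ()
  colouringBelow (suc t) with colouringBelow t | Fin.any? (λ w → L w ≟ t)
  ... | c , sep | no no-rank-t =
    c , λ Lv<1+t → sep (≤∧≢⇒< (m<1+n⇒m≤n Lv<1+t) (λ Lv≡t → no-rank-t (_ , Lv≡t)))
  ... | c , sep | yes (w , Lw≡t)
    with new , new∉ ← length<⇒∃∉ (map c (C w)) (subst (_< m) (sym (length-map c (C w))) (|C|<m w)) =
    updateAt c w (const new) , separates-suc sep Lw≡t new∉

  greedyColouring : ∃ λ (c : Fin n → Fin m) → ∀ {v u} → u ∈ C v → c u ≢ c v
  greedyColouring with c , sep ← colouringBelow (suc (foldr _⊔_ 0 (map L (allFinL n)))) =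
    c , sep (s≤s (∈⇒≤-foldr-⊔ L (∈-allFin _)))

module _ {n} (G : Graph n) where

  adj-sym : ∀ {x y} → adj G x y ≡ true → adj G y x ≡ true
  adj-sym {x} {y} xy = trans (Graph.sym G y x) xy

  adj⇒≢ : ∀ {x y} → adj G x y ≡ true → x ≢ y
  adj⇒≢ {x} xy refl with () ← trans (sym xy) (irrefl G x)

module _ {n} (G : Graph n) (L : Fin n → ℕ) where

  private
    edgeCondition : Fin n → Fin n → Bool
    edgeCondition x y = adj G x y ∧ (L x ≤ᵇ L y)

    pathCondition : Fin n → Fin n → Fin n → Bool
    pathCondition x y z = adj G x z ∧ adj G z y ∧ (L x ≤ᵇ L z) ∧ (L x ≤ᵇ L y) ∧ (L y ≤ᵇ L z)

  strongReach2-refl : ∀ v → T (strongReach2 G L v v)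
  strongReach2-refl v = from (T-∨ {⌊ v ≟F v ⌋}) (inj₁ (fromWitness refl))

  strongReach2-edge : ∀ {x y} → adj G x y ≡ true → L x ≤ L y → T (strongReach2 G L y x)
  strongReach2-edge {x} {y} xy x≤y =
    from (T-∨ {⌊ x ≟F y ⌋}) (inj₂ (from (T-∨ {edgeCondition x y}) (inj₁ (from T-∧ (from T-≡ xy , ≤⇒≤ᵇ x≤y)))))

  strongReach2-path : ∀ {x y z} → x ≢ y → adj G x z ≡ true → adj G z y ≡ true
    → L x ≤ L z → L x ≤ L y → L y ≤ L z → T (strongReach2 G L y x)
  strongReach2-path {x} {y} {z} x≢y xz zy x≤z x≤y y≤z =
    from (T-∨ {⌊ x ≟F y ⌋}) (inj₂ (from (T-∨ {edgeCondition x y}) (inj₂ (from T-∧ (fromWitnessFalse x≢y , via-z)))))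
    where
    via-z : T (any (pathCondition x y) (allFinL n))
    via-z = any⁺ (pathCondition x y) (lose (∈-allFin z)
      (from T-∧⁵ (from T-≡ xz , from T-≡ zy , ≤⇒≤ᵇ x≤z , ≤⇒≤ᵇ x≤y , ≤⇒≤ᵇ y≤z)))

  strongReach2⇒≤ : ∀ {x y} → x ≢ y → T (strongReach2 G L y x) → L x ≤ L y
  strongReach2⇒≤ {x} {y} x≢y reach with to (T-∨ {⌊ x ≟F y ⌋}) reach
  ... | inj₁ x≡y = contradiction (toWitness x≡y) x≢y
  ... | inj₂ reach′ with to (T-∨ {edgeCondition x y}) reach′
  ... | inj₁ edge = ≤ᵇ⇒≤ _ _ (proj₂ (to (T-∧ {adj G x y}) edge))
  ... | inj₂ path
    with z , via-z ← satisfied (any⁻ (pathCondition x y) (allFinL n) (proj₂ (to (T-∧ {not ⌊ x ≟F y ⌋}) path)))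
    with _ , _ , _ , x≤y , _ ← to (T-∧⁵ {adj G x z} {adj G z y} {L x ≤ᵇ L z}) via-z = ≤ᵇ⇒≤ _ _ x≤y

module StrongExD2Colouring {n} (G : Graph n) (σ : Signature G) (L : Fin n → ℕ)
  (L-injective : Injective _≡_ _≡_ L) {k : ℕ} (reach≤k : ∀ v → reachSize G L v ≤ k) where

  reach : Fin n → List (Fin n)
  reach v = filter (λ u → T? (strongReach2 G L v u)) (allFinL n)

  earlier : Fin n → List (Fin n)
  earlier v = filter (λ u → ¬? (u ≟F v)) (reach v)

  |earlier|<k : ∀ v → length (earlier v) < k
  |earlier|<k v = <-≤-trans (filter-notAll (λ u → ¬? (u ≟F v)) (reach v) v-dropped) (reach≤k v)
    where
    v-dropped = lose (∈-filter⁺ (λ u → T? (strongReach2 G L v u)) (∈-allFin v) (strongReach2-refl G L v))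
                     (λ v≢v → v≢v refl)

  ∈-earlier⁺ : ∀ {u v} → u ≢ v → T (strongReach2 G L v u) → u ∈ earlier v
  ∈-earlier⁺ {u} {v} u≢v u-reaches =
    ∈-filter⁺ (λ u → ¬? (u ≟F v)) (∈-filter⁺ (λ u → T? (strongReach2 G L v u)) (∈-allFin u) u-reaches) u≢v

  earlier-< : ∀ {v u} → u ∈ earlier v → L u < L v
  earlier-< {v} u∈ with u∈reach , u≢v ← ∈-filter⁻ (λ u → ¬? (u ≟F v)) u∈ =
    ≤∧≢⇒< (strongReach2⇒≤ G L u≢v (proj₂ (∈-filter⁻ (λ u → T? (strongReach2 G L v u)) {xs = allFinL n} u∈reach)))
          (u≢v ∘ L-injective)

  earlier² : Fin n → List (Fin n)
  earlier² v = earlier v ++ concatMap earlier (earlier v)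

  earlier²-< : ∀ {v u} → u ∈ earlier² v → L u < L v
  earlier²-< {v} u∈ with ∈-++⁻ (earlier v) u∈
  ... | inj₁ u∈earlier = earlier-< u∈earlier
  ... | inj₂ u∈earlier₂ with _ , w∈ , u∈w ← find (∈-concatMap⁻ earlier {xs = earlier v} u∈earlier₂) =
    <-trans (earlier-< u∈w) (earlier-< w∈)

  private
    module Φ = GreedyColouring L L-injective earlier |earlier|<k earlier-<
    module Ψ = GreedyColouring L L-injective earlier²
      (λ v → length-++-concatMap-< earlier |earlier|<k (earlier v) (|earlier|<k v)) earlier²-<

  φ : Fin n → Fin k
  φ = proj₁ Φ.greedyColouring

  φ-separates : ∀ {v u} → u ∈ earlier v → φ u ≢ φ v
  φ-separates = proj₂ Φ.greedyColouring

  ψ : Fin n → Fin (k * k)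
  ψ = proj₁ Ψ.greedyColouring

  ψ-separates : ∀ {v u} → u ∈ earlier² v → ψ u ≢ ψ v
  ψ-separates = proj₂ Ψ.greedyColouring

  φ-injective-on-earlier-neighbours : ∀ {v u z} → adj G v u ≡ true → adj G v z ≡ true
    → L u ≤ L v → L z ≤ L v → φ u ≡ φ z → u ≡ z
  φ-injective-on-earlier-neighbours {v} {u} {z} vu vz u≤v z≤v same with u ≟F z
  ... | yes u≡z = u≡z
  ... | no u≢z with ≤-total (L u) (L z)
  ... | inj₁ u≤z = contradiction same
        (φ-separates (∈-earlier⁺ u≢z (strongReach2-path G L u≢z (adj-sym G vu) vz u≤v u≤z z≤v)))
  ... | inj₂ z≤u = contradiction (sym same)
        (φ-separates (∈-earlier⁺ (u≢z ∘ sym) (strongReach2-path G L (u≢z ∘ sym) (adj-sym G vz) vu z≤v z≤u u≤v)))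

  signBits : Fin n → Fin k → Bool
  signBits v i = does (Fin.any? λ u →
    (adj G v u ≟B true) ×-dec (L u ≤? L v) ×-dec (φ u ≟F i) ×-dec (sign σ v u ≟B true))

  signBits-φ : ∀ {v z} → adj G v z ≡ true → L z ≤ L v → signBits v (φ z) ≡ sign σ v z
  signBits-φ {v} {z} vz z≤v with sign σ v z in vz-sign
  ... | true  = dec-true (Fin.any? _) (z , vz , z≤v , refl , vz-sign)
  ... | false = dec-false (Fin.any? _) no-negative-witness
    where
    no-negative-witness : ¬ ∃ λ u → adj G v u ≡ true × L u ≤ L v × φ u ≡ φ z × sign σ v u ≡ true
    no-negative-witness (u , vu , u≤v , same , vu-sign)
      with refl ← φ-injective-on-earlier-neighbours vu vz u≤v z≤v same
      with () ← trans (sym vz-sign) vu-sign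

  colour : Fin n → Fin ((k * k) * 2 ^ k)
  colour v = combine (ψ v) (bits→Fin (signBits v))

  earliest-end-∈-earlier² : ∀ {x y z} → x ≢ y → adj G x z ≡ true → adj G z y ≡ true
    → L x ≤ L z → L x ≤ L y → x ∈ earlier² y
  earliest-end-∈-earlier² {x} {y} {z} x≢y xz zy x≤z x≤y with ≤-total (L y) (L z)
  ... | inj₁ y≤z = ∈-++⁺ˡ (∈-earlier⁺ x≢y (strongReach2-path G L x≢y xz zy x≤z x≤y y≤z))
  ... | inj₂ z≤y = ∈-++⁺ʳ (earlier y) (∈-concatMap⁺ earlier (lose z∈earlier-y x∈earlier-z))
    where
    z∈earlier-y = ∈-earlier⁺ (adj⇒≢ G zy) (strongReach2-edge G L zy z≤y)
    x∈earlier-z = ∈-earlier⁺ (adj⇒≢ G xz) (strongReach2-edge G L xz x≤z)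

  earliest-middle-signs : ∀ {x y z} → adj G x z ≡ true → adj G z y ≡ true
    → L z ≤ L x → L z ≤ L y → signBits x ≗ signBits y → sign σ x z ≡ sign σ z y
  earliest-middle-signs {x} {y} {z} xz zy z≤x z≤y same = begin
    sign σ x z        ≡⟨ signBits-φ xz z≤x ⟨
    signBits x (φ z)  ≡⟨ same (φ z) ⟩
    signBits y (φ z)  ≡⟨ signBits-φ (adj-sym G zy) z≤y ⟩
    sign σ y z        ≡⟨ signSym σ y z ⟩
    sign σ z y        ∎
    where open ≡-Reasoning

  colour-proper : ∀ x y → StrongExD2Edge G σ x y → colour x ≢ colour y
  colour-proper x y ((x≢y , _) , z , xz , zy , negative) same =
    by-earliest (minimum-of-three (L z) (L x) (L y))
    where
    same-ψ : ψ x ≡ ψ y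
    same-ψ = combine-injectiveˡ (ψ x) _ (ψ y) _ same
    same-bits : signBits x ≗ signBits y
    same-bits = bits→Fin-injective (signBits x) (signBits y) (combine-injectiveʳ (ψ x) _ (ψ y) _ same)
    by-earliest : (L z ≤ L x × L z ≤ L y) ⊎ (L x ≤ L z × L x ≤ L y) ⊎ (L y ≤ L z × L y ≤ L x) → ⊥
    by-earliest (inj₁ (z≤x , z≤y))
      with () ← trans (sym (xor-same (sign σ x z)))
                      (subst (λ s → sign σ x z xor s ≡ true)
                             (sym (earliest-middle-signs xz zy z≤x z≤y same-bits)) negative)
    by-earliest (inj₂ (inj₁ (x≤z , x≤y))) =
      ψ-separates (earliest-end-∈-earlier² x≢y xz zy x≤z x≤y) same-ψ
    by-earliest (inj₂ (inj₂ (y≤z , y≤x))) =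
      ψ-separates (earliest-end-∈-earlier² (x≢y ∘ sym) (adj-sym G zy) (adj-sym G xz) y≤z y≤x) (sym same-ψ)

proposition22 : ∀ {n : ℕ} (G : Graph n) (σ : Signature G) (k : ℕ)
    → IsCol2 G k
    → ProperColouring (StrongExD2Edge G σ) ((k * k) * (2 ^ k))
proposition22 G σ k (((L , L-injective) , maxReach≡k) , _) = colour , colour-proper
  where
  reach≤k : ∀ v → reachSize G L v ≤ k
  reach≤k v = subst (reachSize G L v ≤_) maxReach≡k (∈⇒≤-foldr-⊔ (reachSize G L) (∈-allFin v))
  open StrongExD2Colouring G σ L L-injective reach≤k
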